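{- Let X be any of the variants E, S, G of the halting problem. For every generic-case tester $T$ for X there is a generic-case tester $T'$ for X such that every instance on which $T$ answers ``yes'' is also answered ``yes'' by $T'$, $T'$ answers ``no'' on precisely the same instances as $T$, $T'$ has no hard halting instances, and $T'$ has precisely the same hard non-halting instances as $T$.
   Context: A programming language consists of a finite alphabet $\Sigma$ with $|\Sigma|\ge 2$ and a set of programs (strings over $\Sigma$); every program, on every input string, either halts or runs forever, and programs can be effectively constructed and simulated step by step by other programs. Variants of the halting problem: E — instances are programs, question: does the program halt on the empty input; S — instances are programs, question: does the program halt when given itself as input; G — instances are program–input pairs, question: does the program halt on the input. A generic-case tester for a variant is a program that, on each instance, either halts with a correct answer ``yes'' (the instance halts) or ``no'' (the instance does not halt), or fails to halt. An instance is easy for a tester if the tester correctly answers ``yes'' or ``no'' on it, and hard otherwise. -}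

module Defs where

open import Data.Nat using (ℕ; zero; suc; _≤_)
open import Data.Fin using (Fin; zero; suc)
open import Data.List using (List; []; _∷_; _++_; concatMap)
open import Data.Maybe using (Maybe; just; nothing)
open import Data.Product using (Σ; ∃; ∃-syntax; _×_; _,_)
open import Data.Sum using (_⊎_)
open import Relation.Nullary using (¬_)
open import Relation.Binary.PropositionalEquality using (_≡_)
open import Function.Bundles using (_⇔_)

-- An abstract programming language.
--  * alphabet: Fin (2 + k), a finite alphabet with at least 2 symbols;
--  * programs: a set of strings (predicate IsProg);
--  * step-by-step semantics: run p x n = just o  iff  program p on input x
--    has halted with output o within n steps (monotone in n, so the
--    output is determined); run is an (Agda, hence effective) function,
--    i.e. programs can be simulated step by step;
--  * effective construction: every effectively given step-indexed partial
--    computation on strings (a monotone Agda function) is realised by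
--    some program.
record Lang : Set₁ where
  field
    k      : ℕ
  Sym : Set
  Sym = Fin (suc (suc k))
  Str : Set
  Str = List Sym
  field
    IsProg : Str → Set
    run    : Str → Str → ℕ → Maybe Str
    run-mono : ∀ p x n m o → n ≤ m → run p x n ≡ just o → run p x m ≡ just o
    realize  : (f : Str → ℕ → Maybe Str) →
               (∀ x n m o → n ≤ m → f x n ≡ just o → f x m ≡ just o) →
               Σ Str λ p → IsProg p ×
                 (∀ x o → (∃[ n ] f x n ≡ just o) ⇔ (∃[ n ] run p x n ≡ just o))

data Variant : Set where
  E S G : Variant

module _ (L : Lang) where
  open Lang L

  Prog : Set
  Prog = Σ Str IsProg

  Halts : Str → Str → Set
  Halts p x = ∃[ n ] ∃[ o ] run p x n ≡ just o

  yesW noW : Str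
  yesW = zero ∷ []
  noW  = suc zero ∷ []

  -- fixed (decodable) encoding of a program–input pair as a string:
  -- each symbol s of p becomes "0 s", then the separator "1", then x.
  pairEnc : Str → Str → Str
  pairEnc p x = concatMap (λ s → zero ∷ s ∷ []) p ++ (suc zero ∷ x)

  Inst : Variant → Set
  Inst E = Prog
  Inst S = Prog
  Inst G = Prog × Str

  enc : (X : Variant) → Inst X → Str
  enc E (p , _) = p
  enc S (p , _) = p
  enc G ((p , _) , x) = pairEnc p x

  HaltsI : (X : Variant) → Inst X → Set
  HaltsI E (p , _) = Halts p []
  HaltsI S (p , _) = Halts p p
  HaltsI G ((p , _) , x) = Halts p x

  Answers : (X : Variant) → Str → Inst X → Str → Set
  Answers X T i a = ∃[ n ] run T (enc X i) n ≡ just a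

  IsTester : Variant → Str → Set
  IsTester X T = IsProg T ×
    (∀ (i : Inst X) n o → run T (enc X i) n ≡ just o →
       (o ≡ yesW × HaltsI X i) ⊎ (o ≡ noW × ¬ HaltsI X i))

  Easy : (X : Variant) → Str → Inst X → Set
  Easy X T i = Answers X T i yesW ⊎ Answers X T i noW

  Hard : (X : Variant) → Str → Inst X → Set
  Hard X T i = ¬ Easy X T i

module Submission where

open import Defs
open import Data.Product using (Σ; _×_; _,_; proj₁; proj₂; ∃-syntax)
open import Data.Sum using (_⊎_; inj₁; inj₂)
open import Data.Nat using (ℕ; zero; suc; _≤_; _≤′_; ≤′-refl; ≤′-step)
open import Data.Nat.Properties using (≤⇒≤′)
open import Data.Fin using (zero; suc)
open import Data.List using ([]; _∷_)
open import Data.Maybe using (Maybe; just; nothing; map; maybe′; _<∣>_)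
open import Data.Maybe.Properties using (map-just)
open import Data.Empty using (⊥-elim)
open import Function using (id; const; _∘_)
open import Function.Bundles using (_⇔_; mk⇔; Equivalence)
open import Function.Properties.Equivalence using () renaming (sym to ⇔-sym; trans to ⇔-trans)
open import Relation.Nullary using (¬_; contraposition)
open import Relation.Binary.PropositionalEquality using (_≡_; _≢_; refl; sym)

-- T' runs T and, in parallel, the instance itself, answering like T
-- if T answers first and ``yes'' as soon as the instance halts.  A halting
-- instance is thus always answered, and since a correct tester can never
-- contradict T, T' gives T's answer whenever T gives one.  On inputs that
-- encode no instance T may say ``no'' after the simulation has halted, so
-- the first answer found is latched to keep the run monotone in the step count.

module _ {A : Set} where

  Yields : (ℕ → Maybe A) → A → Set
  Yields h a = ∃[ n ] h n ≡ just a

  Terminates : (ℕ → Maybe A) → Set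
  Terminates h = ∃[ n ] ∃[ a ] h n ≡ just a

  <∣>-just-inv : ∀ {mx my : Maybe A} {z} → (mx <∣> my) ≡ just z →
                 mx ≡ just z ⊎ my ≡ just z
  <∣>-just-inv {just x}  eq = inj₁ eq
  <∣>-just-inv {nothing} eq = inj₂ eq

  <∣>-justˡ : ∀ {mx : Maybe A} {x} my → mx ≡ just x → (mx <∣> my) ≡ just x
  <∣>-justˡ my refl = refl

  <∣>-justʳ : ∀ (mx : Maybe A) {my y} → my ≡ just y → ∃[ z ] (mx <∣> my) ≡ just z
  <∣>-justʳ (just x) eq   = x , refl
  <∣>-justʳ nothing  refl = _ , refl

  firstJust : (ℕ → Maybe A) → ℕ → Maybe A
  firstJust h zero    = h zero
  firstJust h (suc n) = firstJust h n <∣> h (suc n)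

  firstJust-mono : ∀ h {n m a} → n ≤ m → firstJust h n ≡ just a → firstJust h m ≡ just a
  firstJust-mono h = go ∘ ≤⇒≤′
    where
    go : ∀ {n m a} → n ≤′ m → firstJust h n ≡ just a → firstJust h m ≡ just a
    go ≤′-refl       eq = eq
    go (≤′-step n≤m) eq = <∣>-justˡ _ (go n≤m eq)

  firstJust-sound : ∀ h n {a} → firstJust h n ≡ just a → Yields h a
  firstJust-sound h zero    eq = zero , eq
  firstJust-sound h (suc n) eq with <∣>-just-inv {mx = firstJust h n} eq
  ... | inj₁ earlier = firstJust-sound h n earlier
  ... | inj₂ now     = suc n , now

  firstJust-complete : ∀ h n {a} → h n ≡ just a → ∃[ b ] firstJust h n ≡ just b
  firstJust-complete h zero    eq = _ , eq
  firstJust-complete h (suc n) eq = <∣>-justʳ (firstJust h n) eq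

map-const-just-inv : ∀ {A B : Set} {b c : B} {mx : Maybe A} →
                     map (const b) mx ≡ just c → c ≡ b × ∃[ x ] mx ≡ just x
map-const-just-inv {mx = just x} refl = refl , x , refl

module _ (L : Lang) where
  open Lang L

  decodePair : Str → Maybe (Str × Str)
  decodePair (zero ∷ s ∷ r) = map (λ (p , y) → s ∷ p , y) (decodePair r)
  decodePair (suc zero ∷ r) = just ([] , r)
  decodePair _              = nothing

  decodePair-pairEnc : ∀ p x → decodePair (pairEnc L p x) ≡ just (p , x)
  decodePair-pairEnc []      x = refl
  decodePair-pairEnc (s ∷ p) x = map-just (decodePair-pairEnc p x)

  simulate : Variant → Str → ℕ → Maybe Str
  simulate E x n = run x [] n
  simulate S x n = run x x n
  simulate G x n = maybe′ (λ (p , y) → run p y n) nothing (decodePair x)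

  simulate-halts : ∀ X (i : Inst L X) → Terminates (simulate X (enc L X i)) ⇔ HaltsI L X i
  simulate-halts E _ = mk⇔ id id
  simulate-halts S _ = mk⇔ id id
  simulate-halts G ((p , _) , x) rewrite decodePair-pairEnc p x = mk⇔ id id

  yes≢no : yesW L ≢ noW L
  yes≢no ()

  module _ {X : Variant} {U : Str} (U-tester : IsTester L X U) where

    answer-correct : ∀ {i a} → Answers L X U i a →
                     (a ≡ yesW L × HaltsI L X i) ⊎ (a ≡ noW L × ¬ HaltsI L X i)
    answer-correct {i} (n , eq) = proj₂ U-tester i n _ eq

    answers⇒easy : ∀ {i a} → Answers L X U i a → Easy L X U i
    answers⇒easy ans with answer-correct ans
    ... | inj₁ (refl , _) = inj₁ ans
    ... | inj₂ (refl , _) = inj₂ ans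

    yes⇒halts : ∀ {i} → Answers L X U i (yesW L) → HaltsI L X i
    yes⇒halts ans with answer-correct ans
    ... | inj₁ (_ , halts)   = halts
    ... | inj₂ (yes≡no , _) = ⊥-elim (yes≢no yes≡no)

    easy⇔no : ∀ {i} → ¬ HaltsI L X i → Easy L X U i ⇔ Answers L X U i (noW L)
    easy⇔no ¬halts = mk⇔ to inj₂
      where
      to : Easy L X U _ → Answers L X U _ (noW L)
      to (inj₁ yes) = ⊥-elim (¬halts (yes⇒halts yes))
      to (inj₂ no)  = no

  answers-unique : ∀ {X U V i a b} → IsTester L X U → IsTester L X V →
                   Answers L X U i a → Answers L X V i b → a ≡ b
  answers-unique U-tester V-tester ansU ansV
    with answer-correct U-tester ansU | answer-correct V-tester ansV
  ... | inj₁ (refl , _)     | inj₁ (refl , _)     = refl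
  ... | inj₂ (refl , _)     | inj₂ (refl , _)     = refl
  ... | inj₁ (_ , halts)    | inj₂ (_ , ¬halts)   = ⊥-elim (¬halts halts)
  ... | inj₂ (_ , ¬halts)   | inj₁ (_ , halts)    = ⊥-elim (¬halts halts)

module Boost (L : Lang) (X : Variant) (T : Lang.Str L) (T-tester : IsTester L X T) where
  open Lang L
  open Equivalence using (to; from)

  step : Str → ℕ → Maybe Str
  step x n = run T x n <∣> map (const (yesW L)) (simulate L X x n)

  step-sound : ∀ {x n o} → step x n ≡ just o →
               run T x n ≡ just o ⊎ (o ≡ yesW L × Terminates (simulate L X x))
  step-sound {x} {n} eq with <∣>-just-inv {mx = run T x n} eq
  ... | inj₁ fromT = inj₁ fromT
  ... | inj₂ fromSim with map-const-just-inv fromSim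
  ...   | o≡yes , w , sim = inj₂ (o≡yes , n , w , sim)

  realized : Σ Str λ p → IsProg p ×
               (∀ x o → Yields (firstJust (step x)) o ⇔ Yields (run p x) o)
  realized = realize (firstJust ∘ step) (λ x _ _ _ → firstJust-mono (step x))

  T' : Str
  T' = proj₁ realized

  T'-runs : ∀ x o → Yields (firstJust (step x)) o ⇔ Yields (run T' x) o
  T'-runs = proj₂ (proj₂ realized)

  T'-answer⇒step : ∀ {i o} → Answers L X T' i o → Yields (step (enc L X i)) o
  T'-answer⇒step {i} {o} ans with from (T'-runs (enc L X i) o) ans
  ... | n , eq = firstJust-sound _ n eq

  step⇒T'-answers : ∀ {x n a} → step x n ≡ just a → ∃[ b ] Yields (run T' x) b
  step⇒T'-answers {x} {n} eq with firstJust-complete (step x) n eq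
  ... | b , first = b , to (T'-runs x b) (n , first)

  T'-tester : IsTester L X T'
  T'-tester = proj₁ (proj₂ realized) , correct
    where
    correct : ∀ i n o → run T' (enc L X i) n ≡ just o →
              (o ≡ yesW L × HaltsI L X i) ⊎ (o ≡ noW L × ¬ HaltsI L X i)
    correct i n o eq with T'-answer⇒step {i} (n , eq)
    ... | k , stepped with step-sound stepped
    ...   | inj₁ fromT = answer-correct L T-tester (k , fromT)
    ...   | inj₂ (o≡yes , sim) = inj₁ (o≡yes , to (simulate-halts L X i) sim)

  T-answer⇒T'-answer : ∀ i {a} → Answers L X T i a → Answers L X T' i a
  T-answer⇒T'-answer i (n , eq) with step⇒T'-answers (<∣>-justˡ _ eq)
  ... | b , ans rewrite answers-unique L T-tester T'-tester (n , eq) ans = ans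

  T'-no⇒T-no : ∀ i → Answers L X T' i (noW L) → Answers L X T i (noW L)
  T'-no⇒T-no i ans with T'-answer⇒step ans
  ... | k , stepped with step-sound stepped
  ...   | inj₁ fromT        = k , fromT
  ...   | inj₂ (no≡yes , _) = ⊥-elim (yes≢no L (sym no≡yes))

  halting⇒T'-easy : ∀ i → HaltsI L X i → ¬ Hard L X T' i
  halting⇒T'-easy i halts hard with from (simulate-halts L X i) halts
  ... | n , w , sim with <∣>-justʳ (run T (enc L X i) n) (map-just {f = const (yesW L)} sim)
  ...   | _ , stepped with step⇒T'-answers stepped
  ...     | _ , ans = hard (answers⇒easy L T'-tester ans)

  nonhalting⇒hard⇔ : ∀ i → ¬ HaltsI L X i → Hard L X T' i ⇔ Hard L X T i
  nonhalting⇒hard⇔ i ¬halts = mk⇔ (contraposition (from easy⇔)) (contraposition (to easy⇔))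
    where
    easy⇔ : Easy L X T' i ⇔ Easy L X T i
    easy⇔ = ⇔-trans (easy⇔no L T'-tester ¬halts)
              (⇔-trans (mk⇔ (T'-no⇒T-no i) (T-answer⇒T'-answer i))
                       (⇔-sym (easy⇔no L T-tester ¬halts)))

proposition2 : (L : Lang) (X : Variant) (T : Lang.Str L) → IsTester L X T →
    Σ (Lang.Str L) λ T' → IsTester L X T' ×
      (∀ i → Answers L X T i (yesW L) → Answers L X T' i (yesW L)) ×
      (∀ i → Answers L X T' i (noW L) ⇔ Answers L X T i (noW L)) ×
      (∀ i → HaltsI L X i → ¬ Hard L X T' i) ×
      (∀ i → ¬ HaltsI L X i → (Hard L X T' i ⇔ Hard L X T i))
proposition2 L X T T-tester =
  T' , T'-tester , (λ i → T-answer⇒T'-answer i) ,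
  (λ i → mk⇔ (T'-no⇒T-no i) (T-answer⇒T'-answer i)) ,
  halting⇒T'-easy , nonhalting⇒hard⇔
  where open Boost L X T T-tester
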